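{- Let $n\in\mathbb{N}^\ast$, with $\mathcal{S}$, $\widehat{k}$ and $\boldsymbol{\mathcal{A}}$ as in the context. The map $\boldsymbol{\pi}:A\to\boldsymbol{\mathcal{A}}$ defined by $$\boldsymbol{\pi}(a)=\sum_{k\in\mathcal{S}}\Big(\sum_{\kappa\in\widehat{k}}a_\kappa\Big)\mathbf{k}\qquad (a=(a_1,a_2,\dots)\in A)$$ is a morphism of $\mathbb{Z}$-algebras, i.e. it is $\mathbb{Z}$-linear and satisfies $\boldsymbol{\pi}(a\star b)=\boldsymbol{\pi}(a)\boldsymbol{\pi}(b)$ for all $a,b\in A$.
   Context: $A=\mathbb{Z}^{\mathbb{N}^\ast}$ is the ring of integer sequences $a=(a_1,a_2,\dots)$ with the Dirichlet convolution $(a\star b)_k=\sum_{ij=k}a_ib_j$. Fix $n\in\mathbb{N}^\ast$ and define $i\,\mathcal{R}\,j\iff\lfloor n/i\rfloor=\lfloor n/j\rfloor$ on $\mathbb{N}^\ast$; its classes are intervals, the integers $>n$ form the only unbounded class. $\mathcal{S}$ is the set of largest elements of the bounded classes, and for $k\in\mathcal{S}$, $\widehat{k}$ is the (finite) class whose largest element is $k$. $\boldsymbol{\mathcal{A}}$ is the free $\mathbb{Z}$-module with basis $\{\mathbf{k}:k\in\mathcal{S}\}$, made into a commutative $\mathbb{Z}$-algebra by the bilinear multiplication: for $i,j\in\mathcal{S}$, $\mathbf{i}\mathbf{j}=\mathbf{l}$ if $ij\le n$, where $l\in\mathcal{S}$ is the largest element of the class of $ij$, and $\mathbf{i}\mathbf{j}=0$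 if $ij>n$. (This is the quotient of the semigroup algebra of $\mathbb{N}^\ast/\mathcal{R}$ by the ideal spanned by the unbounded class.) -}

module Defs where

open import Data.Nat as ℕ using (ℕ; zero; suc; _≤_)
open import Data.Nat.DivMod using (_/_)
open import Data.Integer as ℤ using (ℤ)
open import Data.List using (List; map; upTo; foldr)
open import Data.Bool using (Bool; true; false; if_then_else_; _∧_; not)
open import Relation.Nullary.Decidable using (⌊_⌋)
open import Relation.Binary.PropositionalEquality using (_≡_)

sumℤ : List ℤ → ℤ
sumℤ = foldr ℤ._+_ (ℤ.+ 0)

[1‥_] : ℕ → List ℕ
[1‥ m ] = map suc (upTo m)

-- A = ℤ^{ℕ*}: integer sequences indexed by ℕ; index 0 is ignored.
Seq : Set
Seq = ℕ → ℤ

_⋆_ : Seq → Seq → Seq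
(a ⋆ b) k = sumℤ (map (λ i → sumℤ (map (λ j →
              if ⌊ i ℕ.* j ℕ.≟ k ⌋ then a i ℤ.* b j else ℤ.+ 0) [1‥ k ])) [1‥ k ])

_+ˢ_ : Seq → Seq → Seq
(a +ˢ b) k = a k ℤ.+ b k

_·ˢ_ : ℤ → Seq → Seq
(c ·ˢ a) k = c ℤ.* a k

allᵇ : {A : Set} → (A → Bool) → List A → Bool
allᵇ p = foldr (λ x r → p x ∧ r) true

-- ⌊n / k⌋ for k ≥ 1 (value at k = 0 irrelevant).
fl : ℕ → ℕ → ℕ
fl n zero    = 0
fl n (suc k) = n / suc k

R? : ℕ → ℕ → ℕ → Bool
R? n i j = ⌊ fl n i ℕ.≟ fl n j ⌋

-- k ∈ 𝒮: k lies in a bounded class (1 ≤ k ≤ n) and is the largest element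
-- of its class.  Every j > n lies in the unbounded class, so it suffices to
-- check j ∈ {k+1, …, n}.
inS : ℕ → ℕ → Bool
inS n k = ⌊ 1 ℕ.≤? k ⌋ ∧ ⌊ k ℕ.≤? n ⌋
          ∧ allᵇ (λ j → not (⌊ k ℕ.<? j ⌋ ∧ R? n j k)) [1‥ n ]

-- Elements of the free ℤ-module 𝓐 (depending on n) with basis {𝐤 : k ∈ 𝒮}
-- are represented by coefficient functions ℕ → ℤ; only the coefficients at
-- k ∈ 𝒮 are meaningful (𝓐 ≅ ℤ^𝒮 since 𝒮 is finite).
Alg : Set
Alg = ℕ → ℤ

Eq𝓐 : ℕ → Alg → Alg → Set
Eq𝓐 n x y = ∀ k → inS n k ≡ true → x k ≡ y k

_+ᵃ_ : Alg → Alg → Alg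
(x +ᵃ y) k = x k ℤ.+ y k

_·ᵃ_ : ℤ → Alg → Alg
(c ·ᵃ x) k = c ℤ.* x k

-- Multiplication in 𝓐, bilinear extension of: for i, j ∈ 𝒮,
-- 𝐢𝐣 = 𝐥 if ij ≤ n (l ∈ 𝒮 the largest element of the class of ij), else 0.
-- Coefficient at l: Σ over i, j ∈ 𝒮 with ij ≤ n and l ∈ 𝒮, l R ij, of x_i y_j.
mul𝓐 : ℕ → Alg → Alg → Alg
mul𝓐 n x y l = sumℤ (map (λ i → sumℤ (map (λ j →
    if inS n i ∧ inS n j ∧ ⌊ i ℕ.* j ℕ.≤? n ⌋ ∧ inS n l ∧ R? n (i ℕ.* j) l
    then x i ℤ.* y j else ℤ.+ 0) [1‥ n ])) [1‥ n ])

-- π(a) = Σ_{k ∈ 𝒮} (Σ_{κ ∈ k̂} a_κ) 𝐤.  The class k̂ of k ∈ 𝒮 is contained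
-- in {1, …, n}.
π : ℕ → Seq → Alg
π n a k = if inS n k
          then sumℤ (map (λ κ → if R? n κ k then a κ else ℤ.+ 0) [1‥ n ])
          else ℤ.+ 0

-- Each κ ∈ {1, …, n} is equivalent to exactly one element of 𝒮, the largest j ≤ n with
-- ⌊n/j⌋ = ⌊n/κ⌋.  The relation R is a congruence for multiplication of positive integers,
-- since ⌊n/(ij)⌋ = ⌊⌊n/i⌋/j⌋, and ij ≤ n iff ⌊n/(ij)⌋ ≥ 1, so whether ij ≤ n depends only on
-- the class of ij.  Expanding (π(a)π(b))_l over the classes of i and j, the weight of a_i b_j
-- is the condition "ij ≤ n and ij R l" evaluated at the representatives of i and j, hence at
-- i and j themselves; this is also the weight of a_i b_j in π(a ⋆ b)_l.
module Submission where

open import Defs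
open import Data.Nat using (ℕ; _≤_)
open import Data.Integer using (ℤ)
open import Data.Product using (_×_)

open import Data.Bool using (Bool; true; false; if_then_else_; _∧_; not)
open import Data.Bool.Properties using (∧-conicalˡ; ∧-conicalʳ)
open import Data.Integer using (0ℤ; _+_; _*_)
import Data.Integer.Properties as ℤₚ
open import Algebra.Properties.CommutativeSemigroup ℤₚ.+-commutativeSemigroup using (interchange)
open import Data.List using ([]; _∷_; map; upTo; _∷ʳ_)
open import Data.List.Properties using (upTo-∷ʳ; map-++)
open import Data.List.Membership.Propositional using (_∈_)
open import Data.List.Membership.Propositional.Properties using (∈-map⁺; ∈-map⁻; ∈-upTo⁺; ∈-upTo⁻)
open import Data.List.Relation.Unary.Any using (here; there)
open import Data.Nat as ℕ using (zero; suc; _<_; z≤n; s≤s; _≤?_; _<?_; _≟_; >-nonZero)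
import Data.Nat.Properties as ℕₚ
open import Data.Nat.DivMod using (_/_; m/n/o≡m/[n*o]; m<n⇒m/n≡0; m≥n⇒m/n>0)
open import Data.Product using (∃-syntax; _,_)
open import Data.Sum using (inj₁; inj₂)
open import Function using (_∘_; _⇔_; mk⇔)
open import Relation.Binary.PropositionalEquality
  using (_≡_; _≢_; refl; sym; trans; cong; cong₂; module ≡-Reasoning)
open import Relation.Binary.Definitions using (tri<; tri≈; tri>)
open import Relation.Nullary using (Dec; yes; no; ¬_; contradiction)
open import Relation.Nullary.Decidable using (⌊_⌋; isYes≗does; does-⇔)

open ≡-Reasoning

⌊⌋-yes : ∀ {A : Set} (a? : Dec A) → A → ⌊ a? ⌋ ≡ true
⌊⌋-yes (yes _) _ = refl
⌊⌋-yes (no ¬a) a = contradiction a ¬a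

⌊⌋-no : ∀ {A : Set} (a? : Dec A) → ¬ A → ⌊ a? ⌋ ≡ false
⌊⌋-no (yes a) ¬a = contradiction a ¬a
⌊⌋-no (no _)  _  = refl

⌊⌋-witness : ∀ {A : Set} (a? : Dec A) → ⌊ a? ⌋ ≡ true → A
⌊⌋-witness (yes a) _ = a

⌊⌋-⇔ : ∀ {A B : Set} → A ⇔ B → (a? : Dec A) (b? : Dec B) → ⌊ a? ⌋ ≡ ⌊ b? ⌋
⌊⌋-⇔ A⇔B a? b? = trans (isYes≗does a?) (trans (does-⇔ A⇔B a? b?) (sym (isYes≗does b?)))

allᵇ-∈ : ∀ {A : Set} (p : A → Bool) {x} xs → allᵇ p xs ≡ true → x ∈ xs → p x ≡ true
allᵇ-∈ p (y ∷ ys) all (here refl)  = ∧-conicalˡ (p y) (allᵇ p ys) all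
allᵇ-∈ p (y ∷ ys) all (there x∈ys) = allᵇ-∈ p ys (∧-conicalʳ (p y) (allᵇ p ys) all) x∈ys

∈-allᵇ : ∀ {A : Set} (p : A → Bool) xs → (∀ {x} → x ∈ xs → p x ≡ true) → allᵇ p xs ≡ true
∈-allᵇ p []       _ = refl
∈-allᵇ p (y ∷ ys) h = cong₂ _∧_ (h (here refl)) (∈-allᵇ p ys (h ∘ there))

∈-[1‥]⁺ : ∀ {j m} → 1 ≤ j → j ≤ m → j ∈ [1‥ m ]
∈-[1‥]⁺ {suc i} _ i<m = ∈-map⁺ suc (∈-upTo⁺ i<m)

∈-[1‥]⁻ : ∀ {j m} → j ∈ [1‥ m ] → j ≤ m
∈-[1‥]⁻ j∈ with _ , i∈ , refl ← ∈-map⁻ suc j∈ = ∈-upTo⁻ i∈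

1≤* : ∀ {i j} → 1 ≤ i → 1 ≤ j → 1 ≤ i ℕ.* j
1≤* = ℕₚ.*-mono-≤

largest-true-≤ : (p : ℕ → Bool) → ∀ {i m} → i ≤ m → p i ≡ true →
  ∃[ j ] i ≤ j × j ≤ m × p j ≡ true × (∀ k → j < k → k ≤ m → p k ≡ false)
largest-true-≤ p {m = zero} z≤n pi = 0 , z≤n , z≤n , pi , λ _ 0<k k≤0 → contradiction k≤0 (ℕₚ.<⇒≱ 0<k)
largest-true-≤ p {i} {suc m} i≤1+m pi with p (suc m) in p[1+m]
... | true = suc m , i≤1+m , ℕₚ.≤-refl , p[1+m] , λ _ m<k k≤m → contradiction k≤m (ℕₚ.<⇒≱ m<k)
... | false with ℕₚ.m≤n⇒m<n∨m≡n i≤1+m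
...   | inj₂ refl = contradiction (trans (sym pi) p[1+m]) λ ()
...   | inj₁ (s≤s i≤m) with largest-true-≤ p i≤m pi
...     | j , i≤j , j≤m , pj , above-j = j , i≤j , ℕₚ.m≤n⇒m≤1+n j≤m , pj , above-j′
  where
  above-j′ : ∀ k → j < k → k ≤ suc m → p k ≡ false
  above-j′ k j<k k≤1+m with ℕₚ.m≤n⇒m<n∨m≡n k≤1+m
  ... | inj₂ refl       = p[1+m]
  ... | inj₁ (s≤s k≤m) = above-j k j<k k≤m

infixr 8 [_]·_

[_]·_ : Bool → ℤ → ℤ
[ b ]· x = if b then x else 0ℤ

[]·-on : ∀ {b} (x : ℤ) → b ≡ true → [ b ]· x ≡ x
[]·-on x refl = refl

[]·-off : ∀ {b} (x : ℤ) → b ≡ false → [ b ]· x ≡ 0ℤ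
[]·-off x refl = refl

[]·-0 : ∀ b → [ b ]· 0ℤ ≡ 0ℤ
[]·-0 true  = refl
[]·-0 false = refl

[]·-+ : ∀ b (x y : ℤ) → [ b ]· (x + y) ≡ [ b ]· x + [ b ]· y
[]·-+ true  x y = refl
[]·-+ false x y = refl

[]·-*ˡ : ∀ b (c x : ℤ) → [ b ]· (c * x) ≡ c * [ b ]· x
[]·-*ˡ true  c x = refl
[]·-*ˡ false c x = sym (ℤₚ.*-zeroʳ c)

[]·-∧ : ∀ b c (x : ℤ) → [ b ∧ c ]· x ≡ [ b ]· [ c ]· x
[]·-∧ true  c x = refl
[]·-∧ false c x = refl

[]·-comm : ∀ b c (x : ℤ) → [ b ]· [ c ]· x ≡ [ c ]· [ b ]· x
[]·-comm true  c     x = refl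
[]·-comm false true  x = refl
[]·-comm false false x = refl

[]·-*-[]· : ∀ r s (x y : ℤ) → [ r ]· x * [ s ]· y ≡ [ r ]· [ s ]· (x * y)
[]·-*-[]· true  true  x y = refl
[]·-*-[]· true  false x y = ℤₚ.*-zeroʳ x
[]·-*-[]· false s     x y = ℤₚ.*-zeroˡ ([ s ]· y)

[]·-regroup : ∀ p q g r s (z : ℤ) → [ p ∧ q ∧ g ]· [ r ]· [ s ]· z ≡ [ p ∧ r ]· [ q ∧ s ]· [ g ]· z
[]·-regroup false q     g r     s     z = refl
[]·-regroup true  q     g false s     z = []·-0 (q ∧ g)
[]·-regroup true  false g true  s     z = refl
[]·-regroup true  true  g true  false z = []·-0 g
[]·-regroup true  true  g true  true  z = refl

∑[1‥_] : ℕ → (ℕ → ℤ) → ℤ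
∑[1‥ zero  ] f = 0ℤ
∑[1‥ suc m ] f = ∑[1‥ m ] f + f (suc m)

sumℤ-∷ʳ : ∀ xs x → sumℤ (xs ∷ʳ x) ≡ sumℤ xs + x
sumℤ-∷ʳ []       x = trans (ℤₚ.+-identityʳ x) (sym (ℤₚ.+-identityˡ x))
sumℤ-∷ʳ (y ∷ xs) x = trans (cong (y +_) (sumℤ-∷ʳ xs x)) (sym (ℤₚ.+-assoc y (sumℤ xs) x))

sumℤ-[1‥] : ∀ m (f : ℕ → ℤ) → sumℤ (map f [1‥ m ]) ≡ ∑[1‥ m ] f
sumℤ-[1‥] zero    f = refl
sumℤ-[1‥] (suc m) f = begin
  sumℤ (map f (map suc (upTo (suc m))))  ≡⟨ cong (sumℤ ∘ map f ∘ map suc) (sym (upTo-∷ʳ m)) ⟩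
  sumℤ (map f (map suc (upTo m ∷ʳ m)))   ≡⟨ cong (sumℤ ∘ map f) (map-++ suc (upTo m) _) ⟩
  sumℤ (map f ([1‥ m ] ∷ʳ suc m))        ≡⟨ cong sumℤ (map-++ f [1‥ m ] _) ⟩
  sumℤ (map f [1‥ m ] ∷ʳ f (suc m))      ≡⟨ sumℤ-∷ʳ (map f [1‥ m ]) (f (suc m)) ⟩
  sumℤ (map f [1‥ m ]) + f (suc m)       ≡⟨ cong (_+ f (suc m)) (sumℤ-[1‥] m f) ⟩
  ∑[1‥ m ] f + f (suc m)                 ∎

∑-cong : ∀ m {f g : ℕ → ℤ} → (∀ i → 1 ≤ i → i ≤ m → f i ≡ g i) → ∑[1‥ m ] f ≡ ∑[1‥ m ] g
∑-cong zero    f≡g = refl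
∑-cong (suc m) f≡g =
  cong₂ _+_ (∑-cong m (λ i 1≤i i≤m → f≡g i 1≤i (ℕₚ.m≤n⇒m≤1+n i≤m))) (f≡g (suc m) (s≤s z≤n) ℕₚ.≤-refl)

sumℤ-[1‥]² : ∀ m k (f : ℕ → ℕ → ℤ) →
  sumℤ (map (λ i → sumℤ (map (f i) [1‥ m ])) [1‥ k ]) ≡ ∑[1‥ k ] λ i → ∑[1‥ m ] (f i)
sumℤ-[1‥]² m k f = trans (sumℤ-[1‥] k _) (∑-cong k (λ i _ _ → sumℤ-[1‥] m (f i)))

∑-zero : ∀ m {f : ℕ → ℤ} → (∀ i → 1 ≤ i → i ≤ m → f i ≡ 0ℤ) → ∑[1‥ m ] f ≡ 0ℤ
∑-zero zero    f≡0 = refl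
∑-zero (suc m) f≡0 =
  cong₂ _+_ (∑-zero m (λ i 1≤i i≤m → f≡0 i 1≤i (ℕₚ.m≤n⇒m≤1+n i≤m))) (f≡0 (suc m) (s≤s z≤n) ℕₚ.≤-refl)

∑-+ : ∀ m (f g : ℕ → ℤ) → ∑[1‥ m ] (λ i → f i + g i) ≡ ∑[1‥ m ] f + ∑[1‥ m ] g
∑-+ zero    f g = refl
∑-+ (suc m) f g = trans (cong (_+ (f (suc m) + g (suc m))) (∑-+ m f g))
                        (interchange (∑[1‥ m ] f) (∑[1‥ m ] g) (f (suc m)) (g (suc m)))

∑-*ˡ : ∀ m c (f : ℕ → ℤ) → c * ∑[1‥ m ] f ≡ ∑[1‥ m ] λ i → c * f i
∑-*ˡ zero    c f = ℤₚ.*-zeroʳ c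
∑-*ˡ (suc m) c f = trans (ℤₚ.*-distribˡ-+ c (∑[1‥ m ] f) (f (suc m)))
                         (cong (_+ c * f (suc m)) (∑-*ˡ m c f))

∑-*ʳ : ∀ m c (f : ℕ → ℤ) → ∑[1‥ m ] f * c ≡ ∑[1‥ m ] λ i → f i * c
∑-*ʳ m c f = trans (ℤₚ.*-comm (∑[1‥ m ] f) c)
                   (trans (∑-*ˡ m c f) (∑-cong m (λ i _ _ → ℤₚ.*-comm c (f i))))

∑-*-∑ : ∀ m k (f g : ℕ → ℤ) → ∑[1‥ m ] f * ∑[1‥ k ] g ≡ ∑[1‥ m ] λ i → ∑[1‥ k ] λ j → f i * g j
∑-*-∑ m k f g = trans (∑-*ʳ m (∑[1‥ k ] g) f) (∑-cong m (λ i _ _ → ∑-*ˡ k (f i) g))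

∑-[]· : ∀ m b (f : ℕ → ℤ) → [ b ]· ∑[1‥ m ] f ≡ ∑[1‥ m ] λ i → [ b ]· f i
∑-[]· m true  f = refl
∑-[]· m false f = sym (∑-zero m (λ _ _ _ → refl))

∑-comm : ∀ m k (f : ℕ → ℕ → ℤ) →
  ∑[1‥ k ] (λ i → ∑[1‥ m ] (f i)) ≡ ∑[1‥ m ] λ j → ∑[1‥ k ] λ i → f i j
∑-comm m zero    f = sym (∑-zero m (λ _ _ _ → refl))
∑-comm m (suc k) f = trans (cong (_+ ∑[1‥ m ] (f (suc k))) (∑-comm m k f))
                           (sym (∑-+ m (λ j → ∑[1‥ k ] λ i → f i j) (f (suc k))))

∑-interchange : ∀ m (f : ℕ → ℕ → ℕ → ℕ → ℤ) →
  (∑[1‥ m ] λ i → ∑[1‥ m ] λ j → ∑[1‥ m ] λ i′ → ∑[1‥ m ] λ j′ → f i j i′ j′) ≡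
  (∑[1‥ m ] λ i′ → ∑[1‥ m ] λ j′ → ∑[1‥ m ] λ i → ∑[1‥ m ] λ j → f i j i′ j′)
∑-interchange m f = begin
  (∑[1‥ m ] λ i → ∑[1‥ m ] λ j → ∑[1‥ m ] λ i′ → ∑[1‥ m ] λ j′ → f i j i′ j′)
    ≡⟨ ∑-cong m (λ i _ _ → ∑-comm m m (λ j i′ → ∑[1‥ m ] λ j′ → f i j i′ j′)) ⟩
  (∑[1‥ m ] λ i → ∑[1‥ m ] λ i′ → ∑[1‥ m ] λ j → ∑[1‥ m ] λ j′ → f i j i′ j′)
    ≡⟨ ∑-comm m m (λ i i′ → ∑[1‥ m ] λ j → ∑[1‥ m ] λ j′ → f i j i′ j′) ⟩
  (∑[1‥ m ] λ i′ → ∑[1‥ m ] λ i → ∑[1‥ m ] λ j → ∑[1‥ m ] λ j′ → f i j i′ j′)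
    ≡⟨ ∑-cong m (λ i′ _ _ → ∑-cong m (λ i _ _ → ∑-comm m m (λ j j′ → f i j i′ j′))) ⟩
  (∑[1‥ m ] λ i′ → ∑[1‥ m ] λ i → ∑[1‥ m ] λ j′ → ∑[1‥ m ] λ j → f i j i′ j′)
    ≡⟨ ∑-cong m (λ i′ _ _ → ∑-comm m m (λ i j′ → ∑[1‥ m ] λ j → f i j i′ j′)) ⟩
  (∑[1‥ m ] λ i′ → ∑[1‥ m ] λ j′ → ∑[1‥ m ] λ i → ∑[1‥ m ] λ j → f i j i′ j′)
    ∎

∑-extend : ∀ {m m′} {f : ℕ → ℤ} → m ≤ m′ → (∀ i → m < i → i ≤ m′ → f i ≡ 0ℤ) →
  ∑[1‥ m ] f ≡ ∑[1‥ m′ ] f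
∑-extend {m} {m′} {f} m≤m′ f≡0 with ℕₚ.m≤n⇒m<n∨m≡n m≤m′
... | inj₂ refl = refl
∑-extend {m} {suc m′} {f} _ f≡0 | inj₁ (s≤s m≤m′) = begin
  ∑[1‥ m ] f                   ≡⟨ ∑-extend m≤m′ (λ i m<i i≤m′ → f≡0 i m<i (ℕₚ.m≤n⇒m≤1+n i≤m′)) ⟩
  ∑[1‥ m′ ] f                  ≡⟨ ℤₚ.+-identityʳ (∑[1‥ m′ ] f) ⟨
  ∑[1‥ m′ ] f + 0ℤ             ≡⟨ cong (∑[1‥ m′ ] f +_) (f≡0 (suc m′) (s≤s m≤m′) ℕₚ.≤-refl) ⟨
  ∑[1‥ m′ ] f + f (suc m′)     ∎

∑-single : ∀ {m i₀} {f : ℕ → ℤ} → 1 ≤ i₀ → i₀ ≤ m →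
  (∀ i → 1 ≤ i → i ≤ m → i ≢ i₀ → f i ≡ 0ℤ) → ∑[1‥ m ] f ≡ f i₀
∑-single {zero} (s≤s _) ()
∑-single {suc m} {i₀} {f} 1≤i₀ i₀≤1+m f≡0 with ℕₚ.m≤n⇒m<n∨m≡n i₀≤1+m
... | inj₂ refl = trans (cong (_+ f (suc m)) (∑-zero m below)) (ℤₚ.+-identityˡ (f (suc m)))
  where
  below : ∀ i → 1 ≤ i → i ≤ m → f i ≡ 0ℤ
  below i 1≤i i≤m = f≡0 i 1≤i (ℕₚ.m≤n⇒m≤1+n i≤m) (ℕₚ.<⇒≢ (s≤s i≤m))
... | inj₁ (s≤s i₀≤m) = trans (cong₂ _+_ (∑-single 1≤i₀ i₀≤m below) top) (ℤₚ.+-identityʳ (f i₀))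
  where
  below : ∀ i → 1 ≤ i → i ≤ m → i ≢ i₀ → f i ≡ 0ℤ
  below i 1≤i i≤m = f≡0 i 1≤i (ℕₚ.m≤n⇒m≤1+n i≤m)
  top : f (suc m) ≡ 0ℤ
  top = f≡0 (suc m) (s≤s z≤n) ℕₚ.≤-refl (ℕₚ.<⇒≢ (s≤s i₀≤m) ∘ sym)

∑-δ : ∀ m {k} (f : ℕ → ℤ) → 1 ≤ k → ∑[1‥ m ] (λ κ → [ ⌊ k ≟ κ ⌋ ]· f κ) ≡ [ ⌊ k ≤? m ⌋ ]· f k
∑-δ m {k} f 1≤k with k ≤? m
... | yes k≤m = trans (∑-single 1≤k k≤m off) (cong ([_]· f k) (⌊⌋-yes (k ≟ k) refl))
  where
  off : ∀ κ → 1 ≤ κ → κ ≤ m → κ ≢ k → [ ⌊ k ≟ κ ⌋ ]· f κ ≡ 0ℤ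
  off κ _ _ κ≢k = []·-off (f κ) (⌊⌋-no (k ≟ κ) (κ≢k ∘ sym))
... | no k≰m = ∑-zero m (λ κ _ κ≤m → []·-off (f κ) (⌊⌋-no (k ≟ κ) (λ { refl → k≰m κ≤m })))

⋆-as-∑ : ∀ (a b : Seq) {κ m} → κ ≤ m →
  (a ⋆ b) κ ≡ ∑[1‥ m ] λ i → ∑[1‥ m ] λ j → [ ⌊ i ℕ.* j ≟ κ ⌋ ]· (a i * b j)
⋆-as-∑ a b {κ} {m} κ≤m = begin
  (a ⋆ b) κ
    ≡⟨ sumℤ-[1‥]² κ κ (λ i j → [ ⌊ i ℕ.* j ≟ κ ⌋ ]· (a i * b j)) ⟩
  (∑[1‥ κ ] λ i → ∑[1‥ κ ] λ j → [ ⌊ i ℕ.* j ≟ κ ⌋ ]· (a i * b j))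
    ≡⟨ ∑-cong κ (λ i 1≤i _ → ∑-extend κ≤m (λ j κ<j _ →
         off (ℕₚ.<-≤-trans κ<j (ℕₚ.m≤n*m j i {{>-nonZero 1≤i}})))) ⟩
  (∑[1‥ κ ] λ i → ∑[1‥ m ] λ j → [ ⌊ i ℕ.* j ≟ κ ⌋ ]· (a i * b j))
    ≡⟨ ∑-extend κ≤m (λ i κ<i _ → ∑-zero m (λ j 1≤j _ →
         off (ℕₚ.<-≤-trans κ<i (ℕₚ.m≤m*n i j {{>-nonZero 1≤j}})))) ⟩
  (∑[1‥ m ] λ i → ∑[1‥ m ] λ j → [ ⌊ i ℕ.* j ≟ κ ⌋ ]· (a i * b j))
    ∎
  where
  off : ∀ {i j} → κ < i ℕ.* j → [ ⌊ i ℕ.* j ≟ κ ⌋ ]· (a i * b j) ≡ 0ℤ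
  off {i} {j} κ<ij = []·-off (a i * b j) (⌊⌋-no (i ℕ.* j ≟ κ) (ℕₚ.<⇒≢ κ<ij ∘ sym))

module _ (n : ℕ) where

  fl-* : ∀ i j → fl n (suc i ℕ.* suc j) ≡ fl n (suc i) / suc j
  fl-* i j = sym (m/n/o≡m/[n*o] n (suc i) (suc j))

  fl-*-congˡ : ∀ {i i′ j} → 1 ≤ i → 1 ≤ i′ → 1 ≤ j → fl n i ≡ fl n i′ → fl n (i ℕ.* j) ≡ fl n (i′ ℕ.* j)
  fl-*-congˡ {suc i} {suc i′} {suc j} _ _ _ i~i′ =
    trans (fl-* i j) (trans (cong (_/ suc j) i~i′) (sym (fl-* i′ j)))

  fl-*-cong : ∀ {i i′ j j′} → 1 ≤ i → 1 ≤ i′ → 1 ≤ j → 1 ≤ j′ →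
    fl n i ≡ fl n i′ → fl n j ≡ fl n j′ → fl n (i ℕ.* j) ≡ fl n (i′ ℕ.* j′)
  fl-*-cong {i} {i′} {j} {j′} 1≤i 1≤i′ 1≤j 1≤j′ i~i′ j~j′ = begin
    fl n (i ℕ.* j)    ≡⟨ fl-*-congˡ 1≤i 1≤i′ 1≤j i~i′ ⟩
    fl n (i′ ℕ.* j)   ≡⟨ cong (fl n) (ℕₚ.*-comm i′ j) ⟩
    fl n (j ℕ.* i′)   ≡⟨ fl-*-congˡ 1≤j 1≤j′ 1≤i′ j~j′ ⟩
    fl n (j′ ℕ.* i′)  ≡⟨ cong (fl n) (ℕₚ.*-comm j′ i′) ⟩
    fl n (i′ ℕ.* j′)  ∎

  ≤⇔1≤fl : ∀ {k} → 1 ≤ k → (k ≤ n) ⇔ (1 ≤ fl n k)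
  ≤⇔1≤fl {suc k} _ = mk⇔ m≥n⇒m/n>0 λ 1≤n/k →
    ℕₚ.≮⇒≥ (λ n<k → contradiction (m<n⇒m/n≡0 n<k) (ℕₚ.<⇒≢ 1≤n/k ∘ sym))

  ≤?-respects-fl : ∀ {k k′} → 1 ≤ k → 1 ≤ k′ → fl n k ≡ fl n k′ → ⌊ k ≤? n ⌋ ≡ ⌊ k′ ≤? n ⌋
  ≤?-respects-fl {k} {k′} 1≤k 1≤k′ k~k′ = begin
    ⌊ k ≤? n ⌋           ≡⟨ ⌊⌋-⇔ (≤⇔1≤fl 1≤k) (k ≤? n) (1 ≤? fl n k) ⟩
    ⌊ 1 ≤? fl n k ⌋      ≡⟨ cong (λ q → ⌊ 1 ≤? q ⌋) k~k′ ⟩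
    ⌊ 1 ≤? fl n k′ ⌋     ≡⟨ ⌊⌋-⇔ (≤⇔1≤fl 1≤k′) (k′ ≤? n) (1 ≤? fl n k′) ⟨
    ⌊ k′ ≤? n ⌋          ∎

  R?-intro : ∀ i j → fl n i ≡ fl n j → R? n i j ≡ true
  R?-intro i j = ⌊⌋-yes (fl n i ≟ fl n j)

  R?-elim : ∀ i j → R? n i j ≡ true → fl n i ≡ fl n j
  R?-elim i j = ⌊⌋-witness (fl n i ≟ fl n j)

  not-later⇒ : ∀ {k j} → not (⌊ k <? j ⌋ ∧ R? n j k) ≡ true → k < j → fl n j ≢ fl n k
  not-later⇒ {k} {j} h k<j j~k =
    contradiction (trans (sym h) (cong₂ (λ x y → not (x ∧ y)) (⌊⌋-yes (k <? j) k<j) (R?-intro j k j~k)))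
                  λ ()

  ⇒not-later : ∀ {k j} → (k < j → fl n j ≢ fl n k) → not (⌊ k <? j ⌋ ∧ R? n j k) ≡ true
  ⇒not-later {k} {j} h with k <? j
  ... | no _    = refl
  ... | yes k<j = cong not (⌊⌋-no (fl n j ≟ fl n k) (h k<j))

  module _ (k : ℕ) (k∈𝒮 : inS n k ≡ true) where

    private
      no-later-equivalent : Bool
      no-later-equivalent = allᵇ (λ j → not (⌊ k <? j ⌋ ∧ R? n j k)) [1‥ n ]

      k≤n∧no-later : ⌊ k ≤? n ⌋ ∧ no-later-equivalent ≡ true
      k≤n∧no-later = ∧-conicalʳ ⌊ 1 ≤? k ⌋ _ k∈𝒮

    inS⇒1≤ : 1 ≤ k
    inS⇒1≤ = ⌊⌋-witness (1 ≤? k) (∧-conicalˡ ⌊ 1 ≤? k ⌋ _ k∈𝒮)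

    inS⇒≤n : k ≤ n
    inS⇒≤n = ⌊⌋-witness (k ≤? n) (∧-conicalˡ ⌊ k ≤? n ⌋ no-later-equivalent k≤n∧no-later)

    inS⇒maximal : ∀ {j} → k < j → j ≤ n → fl n j ≢ fl n k
    inS⇒maximal {j} k<j j≤n = not-later⇒ (allᵇ-∈ _ [1‥ n ] no-later j∈[1‥n]) k<j
      where
      no-later : no-later-equivalent ≡ true
      no-later = ∧-conicalʳ ⌊ k ≤? n ⌋ no-later-equivalent k≤n∧no-later
      j∈[1‥n] : j ∈ [1‥ n ]
      j∈[1‥n] = ∈-[1‥]⁺ (ℕₚ.<-≤-trans (s≤s z≤n) k<j) j≤n

  maximal⇒inS : ∀ {k} → 1 ≤ k → k ≤ n → (∀ {j} → k < j → j ≤ n → fl n j ≢ fl n k) → inS n k ≡ true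
  maximal⇒inS {k} 1≤k k≤n maximal =
    cong₂ _∧_ (⌊⌋-yes (1 ≤? k) 1≤k)
      (cong₂ _∧_ (⌊⌋-yes (k ≤? n) k≤n)
        (∈-allᵇ _ [1‥ n ] (λ j∈ → ⇒not-later (λ k<j → maximal k<j (∈-[1‥]⁻ j∈)))))

  inS-unique : ∀ {i j} → inS n i ≡ true → inS n j ≡ true → fl n i ≡ fl n j → i ≡ j
  inS-unique {i} {j} i∈𝒮 j∈𝒮 i~j with ℕₚ.<-cmp i j
  ... | tri< i<j _ _ = contradiction (sym i~j) (inS⇒maximal i i∈𝒮 i<j (inS⇒≤n j j∈𝒮))
  ... | tri≈ _ i≡j _ = i≡j
  ... | tri> _ _ j<i = contradiction i~j (inS⇒maximal j j∈𝒮 j<i (inS⇒≤n i i∈𝒮))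

  class-max : ∀ {κ} → 1 ≤ κ → κ ≤ n → ∃[ k ] inS n k ≡ true × fl n κ ≡ fl n k
  class-max {κ} 1≤κ κ≤n with largest-true-≤ (λ j → R? n j κ) κ≤n (R?-intro κ κ refl)
  ... | k , κ≤k , k≤n , k~κ , above-k =
    k , maximal⇒inS (ℕₚ.≤-trans 1≤κ κ≤k) k≤n maximal , sym (R?-elim k κ k~κ)
    where
    maximal : ∀ {j} → k < j → j ≤ n → fl n j ≢ fl n k
    maximal {j} k<j j≤n j~k =
      contradiction (trans (sym (R?-intro j κ (trans j~k (R?-elim k κ k~κ)))) (above-k j k<j j≤n)) λ ()

  class-δ : ∀ {κ k₀} (f : ℕ → ℤ) → inS n k₀ ≡ true → fl n κ ≡ fl n k₀ →
    ∑[1‥ n ] (λ k → [ inS n k ∧ R? n κ k ]· f k) ≡ f k₀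
  class-δ {κ} {k₀} f k₀∈𝒮 κ~k₀ =
    trans (∑-single (inS⇒1≤ k₀ k₀∈𝒮) (inS⇒≤n k₀ k₀∈𝒮) off)
          ([]·-on (f k₀) (cong₂ _∧_ k₀∈𝒮 (R?-intro κ k₀ κ~k₀)))
    where
    off : ∀ k → 1 ≤ k → k ≤ n → k ≢ k₀ → [ inS n k ∧ R? n κ k ]· f k ≡ 0ℤ
    off k _ _ k≢k₀ with inS n k in k∈𝒮 | R? n κ k in κ~k
    ... | false | _     = refl
    ... | true  | false = refl
    ... | true  | true  = contradiction (inS-unique k∈𝒮 k₀∈𝒮 (trans (sym (R?-elim κ k κ~k)) κ~k₀)) k≢k₀

  π-on-𝒮 : ∀ (a : Seq) k → inS n k ≡ true → π n a k ≡ ∑[1‥ n ] λ κ → [ R? n κ k ]· a κ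
  π-on-𝒮 a k k∈𝒮 =
    trans (cong (λ b → [ b ]· sumℤ (map (λ κ → [ R? n κ k ]· a κ) [1‥ n ])) k∈𝒮) (sumℤ-[1‥] n _)

  π-+ : (a b : Seq) → Eq𝓐 n (π n (a +ˢ b)) (π n a +ᵃ π n b)
  π-+ a b k k∈𝒮 = begin
    π n (a +ˢ b) k
      ≡⟨ π-on-𝒮 (a +ˢ b) k k∈𝒮 ⟩
    ∑[1‥ n ] (λ κ → [ R? n κ k ]· (a κ + b κ))
      ≡⟨ ∑-cong n (λ κ _ _ → []·-+ (R? n κ k) (a κ) (b κ)) ⟩
    ∑[1‥ n ] (λ κ → [ R? n κ k ]· a κ + [ R? n κ k ]· b κ)
      ≡⟨ ∑-+ n _ _ ⟩
    ∑[1‥ n ] (λ κ → [ R? n κ k ]· a κ) + ∑[1‥ n ] (λ κ → [ R? n κ k ]· b κ)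
      ≡⟨ cong₂ _+_ (π-on-𝒮 a k k∈𝒮) (π-on-𝒮 b k k∈𝒮) ⟨
    π n a k + π n b k
      ∎

  π-· : (c : ℤ) (a : Seq) → Eq𝓐 n (π n (c ·ˢ a)) (c ·ᵃ π n a)
  π-· c a k k∈𝒮 = begin
    π n (c ·ˢ a) k                              ≡⟨ π-on-𝒮 (c ·ˢ a) k k∈𝒮 ⟩
    ∑[1‥ n ] (λ κ → [ R? n κ k ]· (c * a κ))    ≡⟨ ∑-cong n (λ κ _ _ → []·-*ˡ (R? n κ k) c (a κ)) ⟩
    ∑[1‥ n ] (λ κ → c * [ R? n κ k ]· a κ)      ≡⟨ ∑-*ˡ n c _ ⟨
    c * ∑[1‥ n ] (λ κ → [ R? n κ k ]· a κ)      ≡⟨ cong (c *_) (π-on-𝒮 a k k∈𝒮) ⟨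
    c * π n a k                                 ∎

  module Multiplicativity (a b : Seq) {l : ℕ} (l∈𝒮 : inS n l ≡ true) where

    -- For i, j ∈ 𝒮, lands (i * j) says that 𝐢𝐣 = 𝐥 in 𝓐.
    lands : ℕ → Bool
    lands m = ⌊ m ≤? n ⌋ ∧ R? n m l

    lands-respects-fl : ∀ {m m′} → 1 ≤ m → 1 ≤ m′ → fl n m ≡ fl n m′ → lands m ≡ lands m′
    lands-respects-fl 1≤m 1≤m′ m~m′ =
      cong₂ _∧_ (≤?-respects-fl 1≤m 1≤m′ m~m′) (cong (λ q → ⌊ q ≟ fl n l ⌋) m~m′)

    landing-sum : ℤ
    landing-sum = ∑[1‥ n ] λ i → ∑[1‥ n ] λ j → [ lands (i ℕ.* j) ]· (a i * b j)

    landing : ∀ {i j} → 1 ≤ i → 1 ≤ j →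
      ∑[1‥ n ] (λ κ → [ R? n κ l ]· [ ⌊ i ℕ.* j ≟ κ ⌋ ]· (a i * b j)) ≡ [ lands (i ℕ.* j) ]· (a i * b j)
    landing {i} {j} 1≤i 1≤j = begin
      ∑[1‥ n ] (λ κ → [ R? n κ l ]· [ ⌊ i ℕ.* j ≟ κ ⌋ ]· (a i * b j))
        ≡⟨ ∑-cong n (λ κ _ _ → []·-comm (R? n κ l) _ (a i * b j)) ⟩
      ∑[1‥ n ] (λ κ → [ ⌊ i ℕ.* j ≟ κ ⌋ ]· [ R? n κ l ]· (a i * b j))
        ≡⟨ ∑-δ n (λ κ → [ R? n κ l ]· (a i * b j)) (1≤* 1≤i 1≤j) ⟩
      [ ⌊ i ℕ.* j ≤? n ⌋ ]· [ R? n (i ℕ.* j) l ]· (a i * b j)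
        ≡⟨ []·-∧ ⌊ i ℕ.* j ≤? n ⌋ (R? n (i ℕ.* j) l) (a i * b j) ⟨
      [ lands (i ℕ.* j) ]· (a i * b j)
        ∎

    π-⋆ : π n (a ⋆ b) l ≡ landing-sum
    π-⋆ = begin
      π n (a ⋆ b) l
        ≡⟨ π-on-𝒮 (a ⋆ b) l l∈𝒮 ⟩
      ∑[1‥ n ] (λ κ → [ R? n κ l ]· (a ⋆ b) κ)
        ≡⟨ ∑-cong n (λ κ _ κ≤n → trans (cong ([ R? n κ l ]·_) (⋆-as-∑ a b κ≤n)) (guard-inside κ)) ⟩
      (∑[1‥ n ] λ κ → ∑[1‥ n ] λ i → ∑[1‥ n ] λ j → [ R? n κ l ]· [ ⌊ i ℕ.* j ≟ κ ⌋ ]· (a i * b j))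
        ≡⟨ ∑-comm n n _ ⟩
      (∑[1‥ n ] λ i → ∑[1‥ n ] λ κ → ∑[1‥ n ] λ j → [ R? n κ l ]· [ ⌊ i ℕ.* j ≟ κ ⌋ ]· (a i * b j))
        ≡⟨ ∑-cong n (λ i 1≤i _ → trans (∑-comm n n _) (∑-cong n (λ j 1≤j _ → landing 1≤i 1≤j))) ⟩
      landing-sum
        ∎
      where
      guard-inside : ∀ κ → [ R? n κ l ]· (∑[1‥ n ] λ i → ∑[1‥ n ] λ j → [ ⌊ i ℕ.* j ≟ κ ⌋ ]· (a i * b j)) ≡
                     (∑[1‥ n ] λ i → ∑[1‥ n ] λ j → [ R? n κ l ]· [ ⌊ i ℕ.* j ≟ κ ⌋ ]· (a i * b j))
      guard-inside κ = trans (∑-[]· n (R? n κ l) _) (∑-cong n (λ i _ _ → ∑-[]· n (R? n κ l) _))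

    mul𝓐-guard : ∀ i j → (inS n i ∧ inS n j ∧ ⌊ i ℕ.* j ≤? n ⌋ ∧ inS n l ∧ R? n (i ℕ.* j) l) ≡
                         (inS n i ∧ inS n j ∧ lands (i ℕ.* j))
    mul𝓐-guard i j = cong (λ t → inS n i ∧ inS n j ∧ ⌊ i ℕ.* j ≤? n ⌋ ∧ t ∧ R? n (i ℕ.* j) l) l∈𝒮

    expand : ∀ i j c → (c ≡ true → inS n i ≡ true) → (c ≡ true → inS n j ≡ true) →
      [ c ]· (π n a i * π n b j) ≡
      (∑[1‥ n ] λ i′ → ∑[1‥ n ] λ j′ → [ c ]· ([ R? n i′ i ]· a i′ * [ R? n j′ j ]· b j′))
    expand i j false _ _ = sym (∑-zero n (λ _ _ _ → ∑-zero n (λ _ _ _ → refl)))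
    expand i j true i∈𝒮 j∈𝒮 = begin
      π n a i * π n b j
        ≡⟨ cong₂ _*_ (π-on-𝒮 a i (i∈𝒮 refl)) (π-on-𝒮 b j (j∈𝒮 refl)) ⟩
      ∑[1‥ n ] (λ i′ → [ R? n i′ i ]· a i′) * ∑[1‥ n ] (λ j′ → [ R? n j′ j ]· b j′)
        ≡⟨ ∑-*-∑ n n _ _ ⟩
      (∑[1‥ n ] λ i′ → ∑[1‥ n ] λ j′ → [ R? n i′ i ]· a i′ * [ R? n j′ j ]· b j′)
        ∎

    collapse : ∀ {i′ j′} → 1 ≤ i′ → i′ ≤ n → 1 ≤ j′ → j′ ≤ n →
      (∑[1‥ n ] λ i → ∑[1‥ n ] λ j →
        [ inS n i ∧ inS n j ∧ lands (i ℕ.* j) ]· ([ R? n i′ i ]· a i′ * [ R? n j′ j ]· b j′))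
      ≡ [ lands (i′ ℕ.* j′) ]· (a i′ * b j′)
    collapse {i′} {j′} 1≤i′ i′≤n 1≤j′ j′≤n
      with i₀ , i₀∈𝒮 , i′~i₀ ← class-max 1≤i′ i′≤n | j₀ , j₀∈𝒮 , j′~j₀ ← class-max 1≤j′ j′≤n = begin
      (∑[1‥ n ] λ i → ∑[1‥ n ] λ j →
        [ inS n i ∧ inS n j ∧ lands (i ℕ.* j) ]· ([ R? n i′ i ]· a i′ * [ R? n j′ j ]· b j′))
        ≡⟨ ∑-cong n (λ i _ _ → ∑-cong n (λ j _ _ → regroup i j)) ⟩
      (∑[1‥ n ] λ i → ∑[1‥ n ] λ j →
        [ inS n i ∧ R? n i′ i ]· [ inS n j ∧ R? n j′ j ]· [ lands (i ℕ.* j) ]· (a i′ * b j′))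
        ≡⟨ ∑-cong n (λ i _ _ → ∑-[]· n (inS n i ∧ R? n i′ i) _) ⟨
      ∑[1‥ n ] (λ i → [ inS n i ∧ R? n i′ i ]·
        ∑[1‥ n ] λ j → [ inS n j ∧ R? n j′ j ]· [ lands (i ℕ.* j) ]· (a i′ * b j′))
        ≡⟨ class-δ {i′} {i₀} _ i₀∈𝒮 i′~i₀ ⟩
      ∑[1‥ n ] (λ j → [ inS n j ∧ R? n j′ j ]· [ lands (i₀ ℕ.* j) ]· (a i′ * b j′))
        ≡⟨ class-δ {j′} {j₀} _ j₀∈𝒮 j′~j₀ ⟩
      [ lands (i₀ ℕ.* j₀) ]· (a i′ * b j′)
        ≡⟨ cong ([_]· (a i′ * b j′)) (lands-respects-fl (1≤* 1≤i₀ 1≤j₀) (1≤* 1≤i′ 1≤j′)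
             (fl-*-cong 1≤i₀ 1≤i′ 1≤j₀ 1≤j′ (sym i′~i₀) (sym j′~j₀))) ⟩
      [ lands (i′ ℕ.* j′) ]· (a i′ * b j′)
        ∎
      where
      1≤i₀ : 1 ≤ i₀
      1≤i₀ = inS⇒1≤ i₀ i₀∈𝒮
      1≤j₀ : 1 ≤ j₀
      1≤j₀ = inS⇒1≤ j₀ j₀∈𝒮
      regroup : ∀ i j →
        [ inS n i ∧ inS n j ∧ lands (i ℕ.* j) ]· ([ R? n i′ i ]· a i′ * [ R? n j′ j ]· b j′) ≡
        [ inS n i ∧ R? n i′ i ]· [ inS n j ∧ R? n j′ j ]· [ lands (i ℕ.* j) ]· (a i′ * b j′)
      regroup i j =
        trans (cong ([ inS n i ∧ inS n j ∧ lands (i ℕ.* j) ]·_) ([]·-*-[]· (R? n i′ i) (R? n j′ j) (a i′) (b j′)))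
              ([]·-regroup (inS n i) (inS n j) (lands (i ℕ.* j)) (R? n i′ i) (R? n j′ j) (a i′ * b j′))

    mul𝓐-π : mul𝓐 n (π n a) (π n b) l ≡ landing-sum
    mul𝓐-π = begin
      mul𝓐 n (π n a) (π n b) l
        ≡⟨ sumℤ-[1‥]² n n _ ⟩
      (∑[1‥ n ] λ i → ∑[1‥ n ] λ j →
        [ inS n i ∧ inS n j ∧ ⌊ i ℕ.* j ≤? n ⌋ ∧ inS n l ∧ R? n (i ℕ.* j) l ]· (π n a i * π n b j))
        ≡⟨ ∑-cong n (λ i _ _ → ∑-cong n (λ j _ _ →
             trans (cong ([_]· (π n a i * π n b j)) (mul𝓐-guard i j))
                   (expand i j _ (∧-conicalˡ (inS n i) _)
                                 (∧-conicalˡ (inS n j) _ ∘ ∧-conicalʳ (inS n i) _)))) ⟩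
      (∑[1‥ n ] λ i → ∑[1‥ n ] λ j → ∑[1‥ n ] λ i′ → ∑[1‥ n ] λ j′ →
        [ inS n i ∧ inS n j ∧ lands (i ℕ.* j) ]· ([ R? n i′ i ]· a i′ * [ R? n j′ j ]· b j′))
        ≡⟨ ∑-interchange n _ ⟩
      (∑[1‥ n ] λ i′ → ∑[1‥ n ] λ j′ → ∑[1‥ n ] λ i → ∑[1‥ n ] λ j →
        [ inS n i ∧ inS n j ∧ lands (i ℕ.* j) ]· ([ R? n i′ i ]· a i′ * [ R? n j′ j ]· b j′))
        ≡⟨ ∑-cong n (λ i′ 1≤i′ i′≤n → ∑-cong n (λ j′ 1≤j′ j′≤n → collapse 1≤i′ i′≤n 1≤j′ j′≤n)) ⟩
      landing-sum
        ∎

proposition4 : (n : ℕ) → 1 ≤ n →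
    ((a b : Seq) → Eq𝓐 n (π n (a +ˢ b)) (π n a +ᵃ π n b))
    × ((c : ℤ) (a : Seq) → Eq𝓐 n (π n (c ·ˢ a)) (c ·ᵃ π n a))
    × ((a b : Seq) → Eq𝓐 n (π n (a ⋆ b)) (mul𝓐 n (π n a) (π n b)))
proposition4 n _ =
  π-+ n , π-· n , λ a b l l∈𝒮 →
    let open Multiplicativity n a b {l} l∈𝒮 in trans π-⋆ (sym mul𝓐-π)
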